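{- Let $X$ be a $(95,40,12,20)$ strongly regular graph and let $K$ be a $4$-clique of $X$ that is not contained in any $5$-clique of $X$. For $i\in\{0,1,2,3\}$ let $X_i$ be the set of vertices of $V(X)\setminus V(K)$ having exactly $i$ neighbours in $K$, and suppose $(|X_0|,|X_1|,|X_2|,|X_3|)=(2,31,57,1)$. Then the two vertices of $X_0$ are not adjacent.
   Context: A $k$-regular graph $G$ on $v$ vertices is a $(v,k,\lambda,\mu)$ strongly regular graph if any two distinct adjacent vertices have exactly $\lambda$ common neighbours and any two distinct non-adjacent vertices have exactly $\mu$ common neighbours. -}

module Defs where

open import Data.Nat using (ℕ)
open import Data.Bool using (Bool; true; false; _∧_; T)
open import Data.Fin using (Fin)
open import Data.List using (List; filter; length)
open import Data.List.Base using (allFin)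
open import Relation.Binary.PropositionalEquality using (_≡_)
open import Relation.Nullary using (¬_)
open import Data.Bool using (T?)
open import Data.Product using (_×_; Σ)
open import Data.Bool using (not)
open import Data.Bool.ListAction using (any)
open import Data.Fin using (_≟_)
open import Data.Nat using () renaming (_≟_ to _≟ℕ_)
open import Relation.Nullary.Decidable using (⌊_⌋)

record Graph (v : ℕ) : Set where
  field
    adj     : Fin v → Fin v → Bool
    symm    : ∀ x y → adj x y ≡ adj y x
    irrefl  : ∀ x → adj x x ≡ false
open Graph public

Adj : ∀ {v} → Graph v → Fin v → Fin v → Set
Adj G x y = T (adj G x y)

count : ∀ {v} → (Fin v → Bool) → ℕ
count {v} p = length (filter (λ x → T? (p x)) (allFin v))

degree : ∀ {v} → Graph v → Fin v → ℕ
degree G x = count (adj G x)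

commonNbrs : ∀ {v} → Graph v → Fin v → Fin v → ℕ
commonNbrs G x y = count (λ z → adj G x z ∧ adj G y z)

IsSRG : (v k l m : ℕ) → Graph v → Set
IsSRG v k l m G =
  (∀ x → degree G x ≡ k) ×
  (∀ x y → ¬ (x ≡ y) → Adj G x y → commonNbrs G x y ≡ l) ×
  (∀ x y → ¬ (x ≡ y) → ¬ Adj G x y → commonNbrs G x y ≡ m)

IsClique : ∀ {v k} → Graph v → (Fin k → Fin v) → Set
IsClique G f = ∀ i j → ¬ (i ≡ j) → Adj G (f i) (f j)

Injective : ∀ {v k} → (Fin k → Fin v) → Set
Injective f = ∀ i j → f i ≡ f j → i ≡ j

InImage : ∀ {v k} → (Fin k → Fin v) → Fin v → Set
InImage {k = k} f x = Σ (Fin k) λ i → f i ≡ x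

InFiveClique : ∀ {v} → Graph v → (Fin 4 → Fin v) → Set
InFiveClique {v} G K = Σ (Fin 5 → Fin v) λ L →
  Injective L × IsClique G L × (∀ i → InImage L (K i))

inK : ∀ {v k} → (Fin k → Fin v) → Fin v → Bool
inK {k = k} f x = any (λ i → ⌊ f i ≟ x ⌋) (allFin k)

nbrsInK : ∀ {v k} → Graph v → (Fin k → Fin v) → Fin v → ℕ
nbrsInK {k = k} G f x = length (filter (λ i → T? (adj G x (f i))) (allFin k))

inX : ∀ {v k} → Graph v → (Fin k → Fin v) → ℕ → Fin v → Bool
inX G f i x = not (inK f x) ∧ ⌊ nbrsInK G f x ≟ℕ i ⌋

-- Let u be a vertex of X₀ and double count the pairs (z, i) with z a common
-- neighbour of u and K i: since u is outside K and adjacent to none of it,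
-- there are 4μ = 80 of them, i.e. the neighbours of u have 80 neighbours in K
-- in total.  No neighbour z of u lies in a 5-clique with K, so z has at most 3
-- neighbours in K, and exactly 3 only if z ∈ X₃; hence the total is at most
-- 2·40 + |X₃| = 81.  If the other vertex w of X₀ were a neighbour of u, it would
-- contribute 0 instead of up to 2, and the total would be at most 79.
module Submission where

open import Defs
import Data.Nat.Properties as ℕₚ
open import Algebra.Properties.Semiring.Sum ℕₚ.+-*-semiring
  using (sum-syntax; ∑-comm; ∑-distrib-+; *-distribˡ-sum; sum-cong-≗; sum-remove)
open import Data.Bool using (Bool; true; false; _∧_; T; T?)
open import Data.Bool.Properties using (¬-not)
open import Data.Empty using (⊥-elim)
open import Data.Fin using (Fin; zero; suc; _≟_)
open import Data.List using (filter; length; tabulate)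
open import Data.List.Base using (allFin)
open import Data.List.Membership.Propositional using (lose)
open import Data.List.Membership.Propositional.Properties using (∈-allFin)
open import Data.List.Properties using (length-filter; filter-some; filter-complete; length-tabulate)
open import Data.List.Relation.Unary.All as All using ()
open import Data.List.Relation.Unary.All.Properties using (all-filter)
open import Data.List.Relation.Unary.Any using (satisfied)
open import Data.List.Relation.Unary.Any.Properties using (any⁺; any⁻)
open import Data.Nat using (ℕ; _+_; _*_; _≤_; z≤n)
open import Data.Nat using () renaming (_≟_ to _≟ℕ_)
open import Data.Nat.Properties
  using (≤-reflexive; <-irrefl; +-comm; +-identityʳ; +-mono-≤; +-monoʳ-≤;
         *-monoʳ-≤; m≤m+n; m≤n+m; m≤n⇒m≤n+o; m<1+n⇒m≤n; ≤∧≢⇒<; module ≤-Reasoning)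
open import Data.Product using (_×_; _,_; proj₁; proj₂)
open import Data.Unit using (tt)
open import Data.Vec.Functional using (_∷_)
open import Function using (id; _∘_)
open import Relation.Binary.PropositionalEquality
  using (_≡_; _≢_; refl; sym; trans; cong; cong₂; subst; module ≡-Reasoning)
open import Relation.Nullary using (¬_; yes; no)
open import Relation.Nullary.Decidable using (⌊_⌋; toWitness; fromWitness; isYes≗does; dec-true)

𝟙 : Bool → ℕ
𝟙 false = 0
𝟙 true  = 1

𝟙-∧ : ∀ a b → 𝟙 (a ∧ b) ≡ 𝟙 a * 𝟙 b
𝟙-∧ false b     = refl
𝟙-∧ true  false = refl
𝟙-∧ true  true  = refl

m≤1+n⇒m≤n+𝟙[m≡1+n] : ∀ {m n} → m ≤ ℕ.suc n → m ≤ n + 𝟙 ⌊ m ≟ℕ ℕ.suc n ⌋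
m≤1+n⇒m≤n+𝟙[m≡1+n] {m} {n} m≤1+n with m ≟ℕ ℕ.suc n
... | yes refl   = ≤-reflexive (+-comm 1 n)
... | no m≢1+n = m≤n⇒m≤n+o 0 (m<1+n⇒m≤n (≤∧≢⇒< m≤1+n m≢1+n))

length-filter-tabulate : ∀ {A : Set} {n} (p : A → Bool) (f : Fin n → A) →
  length (filter (λ x → T? (p x)) (tabulate f)) ≡ ∑[ i < n ] 𝟙 (p (f i))
length-filter-tabulate {n = ℕ.zero}  p f = refl
length-filter-tabulate {n = ℕ.suc n} p f with p (f zero)
... | true  = cong ℕ.suc (length-filter-tabulate p (f ∘ suc))
... | false = length-filter-tabulate p (f ∘ suc)

count≡∑ : ∀ {v} (p : Fin v → Bool) → count p ≡ ∑[ x < v ] 𝟙 (p x)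
count≡∑ p = length-filter-tabulate p id

∑-mono-≤ : ∀ {n} {f g : Fin n → ℕ} → (∀ i → f i ≤ g i) → ∑[ i < n ] f i ≤ ∑[ i < n ] g i
∑-mono-≤ {ℕ.zero}  f≤g = z≤n
∑-mono-≤ {ℕ.suc n} f≤g = +-mono-≤ (f≤g zero) (∑-mono-≤ (f≤g ∘ suc))

≤-∑ : ∀ {n} (f : Fin n → ℕ) i → f i ≤ ∑[ j < n ] f j
≤-∑ {ℕ.suc n} f i = subst (f i ≤_) (sym (sum-remove {i = i} f)) (m≤m+n (f i) _)

∑-+-scaled : ∀ {n} c (f g : Fin n → ℕ) →
  ∑[ i < n ] (f i + c * g i) ≡ ∑[ i < n ] f i + c * ∑[ i < n ] g i
∑-+-scaled c f g = trans (∑-distrib-+ f (λ i → c * g i)) (cong (_ +_) (sym (*-distribˡ-sum c g)))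

module _ {v k} (G : Graph v) (K : Fin k → Fin v) where

  Adj-sym : ∀ {x y} → Adj G x y → Adj G y x
  Adj-sym {x} {y} = subst T (symm G x y)

  inK≡false⇒≢ : ∀ {x} → inK K x ≡ false → ∀ i → K i ≢ x
  inK≡false⇒≢ x∉K i refl =
    subst T x∉K (any⁺ _ (lose (∈-allFin i) (fromWitness {a? = K i ≟ K i} refl)))

  ≢⇒inK≡false : ∀ {x} → (∀ i → K i ≢ x) → inK K x ≡ false
  ≢⇒inK≡false {x} x∉K = ¬-not λ x∈K →
    let (i , Ki≟x) = satisfied (any⁻ _ (allFin k) (subst T (sym x∈K) tt))
    in x∉K i (toWitness Ki≟x)

  nbrsInK≡∑ : ∀ x → nbrsInK G K x ≡ ∑[ i < k ] 𝟙 (adj G x (K i))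
  nbrsInK≡∑ x = count≡∑ (λ i → adj G x (K i))

  nbrsInK≤ : ∀ x → nbrsInK G K x ≤ k
  nbrsInK≤ x = subst (nbrsInK G K x ≤_) (length-tabulate id) (length-filter _ (allFin k))

  nbrsInK≡0⇒¬Adj : ∀ {x} → nbrsInK G K x ≡ 0 → ∀ i → ¬ Adj G x (K i)
  nbrsInK≡0⇒¬Adj {x} none i x~Ki =
    <-irrefl (sym none) (filter-some (λ j → T? (adj G x (K j))) (lose (∈-allFin i) x~Ki))

  nbrsInK≡k⇒Adj : ∀ {x} → nbrsInK G K x ≡ k → ∀ i → Adj G x (K i)
  nbrsInK≡k⇒Adj {x} all i =
    All.lookup (subst (All.All _) everyone (all-filter P? (allFin k))) (∈-allFin i)
    where
    P? = λ j → T? (adj G x (K j))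
    everyone = filter-complete P? (trans all (sym (length-tabulate id)))

  inX≡true⇒ : ∀ {i x} → inX G K i x ≡ true → inK K x ≡ false × nbrsInK G K x ≡ i
  inX≡true⇒ {i} {x} _ with inK K x | nbrsInK G K x ≟ℕ i
  ... | false | yes n≡i = refl , n≡i

  X₀⇒¬Adj : ∀ {x} → inX G K 0 x ≡ true → ∀ i → ¬ Adj G x (K i)
  X₀⇒¬Adj x∈X₀ = nbrsInK≡0⇒¬Adj (proj₂ (inX≡true⇒ x∈X₀))

  inX-outside : ∀ {i x} → inK K x ≡ false → inX G K i x ≡ ⌊ nbrsInK G K x ≟ℕ i ⌋
  inX-outside x∉K rewrite x∉K = refl

∑-commonNbrs : ∀ {v k} (G : Graph v) (K : Fin k → Fin v) x →
  ∑[ i < k ] commonNbrs G x (K i) ≡ ∑[ z < v ] (𝟙 (adj G x z) * nbrsInK G K z)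
∑-commonNbrs {v} {k} G K x = begin
  ∑[ i < k ] commonNbrs G x (K i)
    ≡⟨ sum-cong-≗ (λ i → count≡∑ (λ z → adj G x z ∧ adj G (K i) z)) ⟩
  ∑[ i < k ] ∑[ z < v ] 𝟙 (adj G x z ∧ adj G (K i) z)
    ≡⟨ ∑-comm (λ i z → 𝟙 (adj G x z ∧ adj G (K i) z)) ⟩
  ∑[ z < v ] ∑[ i < k ] 𝟙 (adj G x z ∧ adj G (K i) z)
    ≡⟨ sum-cong-≗ (λ z → sum-cong-≗ (𝟙-∧-sym z)) ⟩
  ∑[ z < v ] ∑[ i < k ] (𝟙 (adj G x z) * 𝟙 (adj G z (K i)))
    ≡⟨ sum-cong-≗ (λ z → sym (*-distribˡ-sum (𝟙 (adj G x z)) (λ i → 𝟙 (adj G z (K i))))) ⟩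
  ∑[ z < v ] (𝟙 (adj G x z) * ∑[ i < k ] 𝟙 (adj G z (K i)))
    ≡⟨ sum-cong-≗ (λ z → cong (𝟙 (adj G x z) *_) (sym (nbrsInK≡∑ G K z))) ⟩
  ∑[ z < v ] (𝟙 (adj G x z) * nbrsInK G K z)
    ∎
  where
  open ≡-Reasoning
  𝟙-∧-sym : ∀ z i → 𝟙 (adj G x z ∧ adj G (K i) z) ≡ 𝟙 (adj G x z) * 𝟙 (adj G z (K i))
  𝟙-∧-sym z i rewrite symm G (K i) z = 𝟙-∧ (adj G x z) (adj G z (K i))

module _ {v k} (G : Graph v) {K : Fin k → Fin v} {x : Fin v} where

  ∷-injective : Injective K → (∀ i → K i ≢ x) → Injective (x ∷ K)
  ∷-injective injK x∉K zero    zero    _    = refl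
  ∷-injective injK x∉K zero    (suc j) x≡Kj = ⊥-elim (x∉K j (sym x≡Kj))
  ∷-injective injK x∉K (suc i) zero    Ki≡x = ⊥-elim (x∉K i Ki≡x)
  ∷-injective injK x∉K (suc i) (suc j) Ki≡Kj = cong suc (injK i j Ki≡Kj)

  ∷-isClique : IsClique G K → (∀ i → Adj G x (K i)) → IsClique G (x ∷ K)
  ∷-isClique cliqK x~K zero    zero    i≢j = ⊥-elim (i≢j refl)
  ∷-isClique cliqK x~K zero    (suc j) _   = x~K j
  ∷-isClique cliqK x~K (suc i) zero    _   = Adj-sym G K (x~K i)
  ∷-isClique cliqK x~K (suc i) (suc j) i≢j = cliqK i j (i≢j ∘ cong suc)

module _ {v} (G : Graph v) {K : Fin 4 → Fin v}
         (injK : Injective K) (cliqK : IsClique G K) (maximal : ¬ InFiveClique G K) where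

  outside-nbrsInK≤ : ∀ {x} → (∀ i → K i ≢ x) → nbrsInK G K x ≤ 2 + 𝟙 (inX G K 3 x)
  outside-nbrsInK≤ {x} x∉K =
    subst (λ b → nbrsInK G K x ≤ 2 + 𝟙 b) (sym (inX-outside G K (≢⇒inK≡false G K x∉K)))
      (m≤1+n⇒m≤n+𝟙[m≡1+n] (m<1+n⇒m≤n (≤∧≢⇒< (nbrsInK≤ G K x) not-all)))
    where
    not-all : nbrsInK G K x ≢ 4
    not-all all = maximal
      (x ∷ K , ∷-injective G injK x∉K , ∷-isClique G cliqK (nbrsInK≡k⇒Adj G K all) , λ i → suc i , refl)

  module _ {u w} (u∈X₀ : inX G K 0 u ≡ true) (w∈X₀ : inX G K 0 w ≡ true) (u~w : Adj G u w) where

    -- w is a neighbour of u with no neighbour in K, so it can carry the extra weight 2.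
    X₀-neighbour-weight : ∀ z →
      𝟙 (adj G u z) * nbrsInK G K z + 2 * 𝟙 ⌊ z ≟ w ⌋ ≤ 𝟙 (inX G K 3 z) + 2 * 𝟙 (adj G u z)
    X₀-neighbour-weight z with z ≟ w | adj G u z in u-z
    ... | yes refl | false = ⊥-elim (subst T u-z u~w)
    ... | yes refl | true  rewrite proj₂ (inX≡true⇒ G K w∈X₀) = m≤n+m 2 _
    ... | no _     | false = z≤n
    ... | no _     | true  = begin
      nbrsInK G K z + 0 + 0     ≡⟨ trans (+-identityʳ _) (+-identityʳ _) ⟩
      nbrsInK G K z             ≤⟨ outside-nbrsInK≤ z∉K ⟩
      2 + 𝟙 (inX G K 3 z)       ≡⟨ +-comm 2 _ ⟩
      𝟙 (inX G K 3 z) + 2       ∎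
      where
      open ≤-Reasoning
      z∉K : ∀ i → K i ≢ z
      z∉K i refl = X₀⇒¬Adj G K u∈X₀ i (subst T (sym u-z) tt)

    X₀-edge-bound : ∀ {d μ} → (∀ x → degree G x ≡ d) →
      (∀ x y → x ≢ y → ¬ Adj G x y → commonNbrs G x y ≡ μ) →
      4 * μ + 2 ≤ count (inX G K 3) + 2 * d
    X₀-edge-bound {d} {μ} regular μ-common = begin
      4 * μ + 2
        ≤⟨ +-monoʳ-≤ (4 * μ) (*-monoʳ-≤ 2 w-counted) ⟩
      4 * μ + 2 * ∑[ z < v ] isW z
        ≡⟨ cong (_+ 2 * ∑[ z < v ] isW z) common-total ⟩
      ∑[ z < v ] weight z + 2 * ∑[ z < v ] isW z
        ≡⟨ sym (∑-+-scaled 2 weight isW) ⟩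
      ∑[ z < v ] (weight z + 2 * isW z)
        ≤⟨ ∑-mono-≤ X₀-neighbour-weight ⟩
      ∑[ z < v ] (𝟙 (inX G K 3 z) + 2 * 𝟙 (adj G u z))
        ≡⟨ ∑-+-scaled 2 (𝟙 ∘ inX G K 3) (𝟙 ∘ adj G u) ⟩
      ∑[ z < v ] 𝟙 (inX G K 3 z) + 2 * ∑[ z < v ] 𝟙 (adj G u z)
        ≡⟨ cong₂ _+_ (sym (count≡∑ (inX G K 3))) (cong (2 *_) degree-u) ⟩
      count (inX G K 3) + 2 * d
        ∎
      where
      open ≤-Reasoning
      weight isW : Fin v → ℕ
      weight z = 𝟙 (adj G u z) * nbrsInK G K z
      isW z    = 𝟙 ⌊ z ≟ w ⌋
      w-counted : 1 ≤ ∑[ z < v ] isW z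
      w-counted = subst (_≤ ∑[ z < v ] isW z)
        (cong 𝟙 (trans (isYes≗does (w ≟ w)) (dec-true (w ≟ w) refl))) (≤-∑ isW w)
      u≢K : ∀ i → u ≢ K i
      u≢K i = inK≡false⇒≢ G K (proj₁ (inX≡true⇒ G K u∈X₀)) i ∘ sym
      common-total : 4 * μ ≡ ∑[ z < v ] weight z
      common-total = trans (sym (sum-cong-≗ λ i → μ-common u (K i) (u≢K i) (X₀⇒¬Adj G K u∈X₀ i)))
                           (∑-commonNbrs G K u)
      degree-u : ∑[ z < v ] 𝟙 (adj G u z) ≡ d
      degree-u = trans (sym (count≡∑ (adj G u))) (regular u)

lemma10 : (X : Graph 95) → IsSRG 95 40 12 20 X →
          (K : Fin 4 → Fin 95) → Injective K → IsClique X K →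
          ¬ InFiveClique X K →
          count (inX X K 0) ≡ 2 → count (inX X K 1) ≡ 31 →
          count (inX X K 2) ≡ 57 → count (inX X K 3) ≡ 1 →
          (u w : Fin 95) → inX X K 0 u ≡ true → inX X K 0 w ≡ true →
          ¬ (u ≡ w) → ¬ Adj X u w
lemma10 X (regular , _ , μ-common) K injK cliqK maximal _ _ _ |X₃|≡1 u w u∈X₀ w∈X₀ _ u~w =
  <-irrefl refl (subst (82 ≤_) (cong (_+ 80) |X₃|≡1) bound)
  where
  bound : 82 ≤ count (inX X K 3) + 80
  bound = X₀-edge-bound X injK cliqK maximal u∈X₀ w∈X₀ u~w regular μ-common
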